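{- (i) For every linear hypergraph $\mathcal H=(V,\mathcal E)$ with $V\notin\mathcal E$ there is a hypergraph $\mathcal H'=(V,\mathcal E')$ with $EI(\mathcal H')=\mathcal H$. (ii) Let $\mathcal H=(V,\mathcal E)$ be a hypergraph containing hyperedges $e_1,e_2\in\mathcal E$ with $|e_1\cap e_2|\ge 2$, $e_1\not\subseteq e_2$ and $e_2\not\subseteq e_1$, and let $\mathcal H'=(V,\mathcal E')$ be a hypergraph with $\mathcal H=EI(\mathcal H')$. Then there is a hyperedge $\tilde e\in\mathcal E\setminus\{e_1,e_2\}$ with $e_1\cap e_2\subseteq\tilde e$. (iii) Not every hypergraph $\mathcal H=(V,\mathcal E)$ with $V\notin\mathcal E$ is the edge intersection hypergraph $EI(\mathcal H')$ of some hypergraph $\mathcal H'=(V,\mathcal E')$.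
   Context: A hypergraph $\mathcal H=(V,\mathcal E)$ consists of a finite vertex set $V$ and a set $\mathcal E$ of subsets of $V$ (hyperedges); there are no multiple hyperedges and no loops (no hyperedges of cardinality $1$). $\mathcal H$ is linear if any two distinct hyperedges share at most one vertex. The edge intersection hypergraph of $\mathcal H=(V,\mathcal E)$ is $EI(\mathcal H)=(V,\mathcal E^{EI})$ with $\mathcal E^{EI}=\{e_1\cap e_2 \mid e_1,e_2\in\mathcal E,\ e_1\neq e_2,\ |e_1\cap e_2|\ge 2\}$. -}

module Defs where

open import Data.Nat using (ℕ; _≤_)
open import Data.Fin.Subset using (Subset; _∩_; ∣_∣)
open import Data.Product using (Σ; ∃; _×_)
open import Relation.Binary.PropositionalEquality using (_≡_; _≢_)
open import Function.Bundles using (_⇔_)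

-- A hypergraph on the vertex set V = Fin n is given by its set of
-- hyperedges, a predicate on subsets of Fin n.  (Subset n = Vec Bool n,
-- so ≡ is extensional set equality and there are no multiple edges.)
Edges : ℕ → Set₁
Edges n = Subset n → Set

IsHypergraph : {n : ℕ} → Edges n → Set
IsHypergraph {n} E = (e : Subset n) → E e → 2 ≤ ∣ e ∣

IsLinear : {n : ℕ} → Edges n → Set
IsLinear {n} E = (e₁ e₂ : Subset n) → E e₁ → E e₂ → e₁ ≢ e₂ → ∣ e₁ ∩ e₂ ∣ ≤ 1

EI : {n : ℕ} → Edges n → Edges n
EI {n} E e = Σ (Subset n) λ e₁ → Σ (Subset n) λ e₂ →
  E e₁ × E e₂ × e₁ ≢ e₂ × 2 ≤ ∣ e₁ ∩ e₂ ∣ × e ≡ e₁ ∩ e₂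

_≐_ : {n : ℕ} → Edges n → Edges n → Set
_≐_ {n} E F = (e : Subset n) → E e ⇔ F e

-- (i) Adjoin the full vertex set V: it meets every hyperedge e in e itself,
-- while by linearity two old hyperedges meet in at most one vertex, so the
-- edge intersection hypergraph gives back exactly the old hyperedges.
-- (ii) Write e₁ = a ∩ b and e₂ = c ∩ d with a, b, c, d ∈ E'.  Since e₂ ⊈ e₁,
-- one of a, b (call it p) misses part of e₂; likewise some q ⊇ e₂ from c, d
-- misses part of e₁.  Then p ∩ q ⊇ e₁ ∩ e₂ is a hyperedge of EI(E') distinct
-- from e₁ and e₂.
-- (iii) Two crossing hyperedges {0,1,2}, {0,1,3} with no third one violate (ii).
module Submission where

open import Defs
open import Data.Nat using (ℕ; _≤_; z≤n; s≤s)
open import Data.Nat.Properties using (≤-trans)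
open import Data.Fin.Subset using (Subset; _∩_; _⊆_; ⊤; ∣_∣; inside; outside)
open import Data.Fin.Subset.Properties
  using (_⊆?_; ⊆-refl; ⊆-trans; p⊆q⇒∣p∣≤∣q∣; p∩q⊆p; p∩q⊆q; x∈p∩q⁺; x∈p∩q⁻; ∈⊤; ∩-identityˡ; ∩-identityʳ)
open import Data.Vec using ([]; _∷_)
open import Data.Product using (Σ; _×_; _,_; map)
open import Data.Sum using (_⊎_; inj₁; inj₂)
open import Data.Empty using (⊥-elim)
open import Relation.Binary.PropositionalEquality using (_≡_; _≢_; refl; sym; trans; subst; ≢-sym)
open import Relation.Nullary using (¬_; yes; no)
open import Relation.Nullary.Decidable using (from-no)
open import Function.Bundles using (mk⇔; Equivalence)

open Equivalence

private
  variable
    n : ℕ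

⊆⊈⇒≢ : {a b c : Subset n} → a ⊆ c → ¬ (a ⊆ b) → c ≢ b
⊆⊈⇒≢ a⊆c a⊈b refl = a⊈b a⊆c

⊈-∩ : (g u v : Subset n) → ¬ (g ⊆ u ∩ v) → ¬ (g ⊆ u) ⊎ ¬ (g ⊆ v)
⊈-∩ g u v g⊈u∩v with g ⊆? u | g ⊆? v
... | no g⊈u  | _        = inj₁ g⊈u
... | yes _   | no g⊈v   = inj₂ g⊈v
... | yes g⊆u | yes g⊆v  = ⊥-elim (g⊈u∩v λ x∈g → x∈p∩q⁺ (g⊆u x∈g , g⊆v x∈g))

linear⇒EI-empty : {E : Edges n} → IsLinear E → (e : Subset n) → ¬ EI E e
linear⇒EI-empty lin e (e₁ , e₂ , E₁ , E₂ , e₁≢e₂ , 2≤∣e₁∩e₂∣ , _)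
  with ≤-trans 2≤∣e₁∩e₂∣ (lin e₁ e₂ E₁ E₂ e₁≢e₂)
... | s≤s ()

-- The size guard only matters when |V| < 2, where V would be a loop (and E is empty).
insertFull : Edges n → Edges n
insertFull E e = E e ⊎ (e ≡ ⊤ × 2 ≤ ∣ e ∣)

insertFull-isHypergraph : {E : Edges n} → IsHypergraph E → IsHypergraph (insertFull E)
insertFull-isHypergraph hyp e (inj₁ Ee)          = hyp e Ee
insertFull-isHypergraph hyp e (inj₂ (_ , 2≤∣e∣)) = 2≤∣e∣

EI-insertFull : {E : Edges n} → IsHypergraph E → IsLinear E → ¬ E ⊤ →
                EI (insertFull E) ≐ E
EI-insertFull {n} {E} hyp lin ¬E⊤ e = mk⇔ sound complete
  where
  sound : EI (insertFull E) e → E e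
  sound (e₁ , e₂ , inj₁ E₁ , inj₁ E₂ , rest) =
    ⊥-elim (linear⇒EI-empty lin e (e₁ , e₂ , E₁ , E₂ , rest))
  sound (e₁ , _ , inj₁ E₁ , inj₂ (refl , _) , _ , _ , e≡e₁∩⊤) =
    subst E (sym (trans e≡e₁∩⊤ (∩-identityʳ e₁))) E₁
  sound (_ , e₂ , inj₂ (refl , _) , inj₁ E₂ , _ , _ , e≡⊤∩e₂) =
    subst E (sym (trans e≡⊤∩e₂ (∩-identityˡ e₂))) E₂
  sound (_ , _ , inj₂ (refl , _) , inj₂ (refl , _) , ⊤≢⊤ , _) = ⊥-elim (⊤≢⊤ refl)

  complete : E e → EI (insertFull E) e
  complete Ee =
    e , ⊤ , inj₁ Ee , inj₂ (refl , 2≤∣⊤∣) , (λ e≡⊤ → ¬E⊤ (subst E e≡⊤ Ee)) ,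
    subst (λ s → 2 ≤ ∣ s ∣) e≡e∩⊤ (hyp e Ee) , e≡e∩⊤
    where
    e≡e∩⊤ : e ≡ e ∩ ⊤
    e≡e∩⊤ = sym (∩-identityʳ e)

    2≤∣⊤∣ : 2 ≤ ∣ ⊤ {n} ∣
    2≤∣⊤∣ = ≤-trans (hyp e Ee) (p⊆q⇒∣p∣≤∣q∣ {p = e} {q = ⊤} (λ _ → ∈⊤))

EI-edge-escapes : {E' : Edges n} {f g : Subset n} → EI E' f → ¬ (g ⊆ f) →
                  Σ (Subset n) λ w → E' w × f ⊆ w × ¬ (g ⊆ w)
EI-edge-escapes {g = g} (u , v , E'u , E'v , _ , _ , refl) g⊈u∩v
  with ⊈-∩ g u v g⊈u∩v
... | inj₁ g⊈u = u , E'u , p∩q⊆p u v , g⊈u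
... | inj₂ g⊈v = v , E'v , p∩q⊆q u v , g⊈v

EI-crossing⇒third : {E' : Edges n} {e₁ e₂ : Subset n} → EI E' e₁ → EI E' e₂ →
                    2 ≤ ∣ e₁ ∩ e₂ ∣ → ¬ (e₁ ⊆ e₂) → ¬ (e₂ ⊆ e₁) →
                    Σ (Subset n) λ ẽ → EI E' ẽ × ẽ ≢ e₁ × ẽ ≢ e₂ × (e₁ ∩ e₂) ⊆ ẽ
EI-crossing⇒third {e₁ = e₁} {e₂} EI₁ EI₂ 2≤∣e₁∩e₂∣ e₁⊈e₂ e₂⊈e₁
  with EI-edge-escapes EI₁ e₂⊈e₁ | EI-edge-escapes EI₂ e₁⊈e₂
... | p , E'p , e₁⊆p , e₂⊈p | q , E'q , e₂⊆q , e₁⊈q =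
  p ∩ q , (p , q , E'p , E'q , ⊆⊈⇒≢ e₁⊆p e₁⊈q , ≤-trans 2≤∣e₁∩e₂∣ (p⊆q⇒∣p∣≤∣q∣ e₁∩e₂⊆p∩q) , refl) ,
  ≢-sym (⊆⊈⇒≢ ⊆-refl (λ e₁⊆p∩q → e₁⊈q (⊆-trans e₁⊆p∩q (p∩q⊆q p q)))) ,
  ≢-sym (⊆⊈⇒≢ ⊆-refl (λ e₂⊆p∩q → e₂⊈p (⊆-trans e₂⊆p∩q (p∩q⊆p p q)))) ,
  e₁∩e₂⊆p∩q
  where
  e₁∩e₂⊆p∩q : e₁ ∩ e₂ ⊆ p ∩ q
  e₁∩e₂⊆p∩q x∈ = x∈p∩q⁺ (map e₁⊆p e₂⊆q (x∈p∩q⁻ e₁ e₂ x∈))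

e₀₁₂ e₀₁₃ : Subset 4
e₀₁₂ = inside ∷ inside ∷ inside ∷ outside ∷ []
e₀₁₃ = inside ∷ inside ∷ outside ∷ inside ∷ []

crossingPair : Edges 4
crossingPair e = e ≡ e₀₁₂ ⊎ e ≡ e₀₁₃

crossingPair-isHypergraph : IsHypergraph crossingPair
crossingPair-isHypergraph _ (inj₁ refl) = s≤s (s≤s z≤n)
crossingPair-isHypergraph _ (inj₂ refl) = s≤s (s≤s z≤n)

crossingPair-not-EI : (E' : Edges 4) → ¬ (EI E' ≐ crossingPair)
crossingPair-not-EI E' EI≐
  with EI-crossing⇒third {e₁ = e₀₁₂} {e₀₁₃} (from (EI≐ e₀₁₂) (inj₁ refl)) (from (EI≐ e₀₁₃) (inj₂ refl))
                         (s≤s (s≤s z≤n)) (from-no (e₀₁₂ ⊆? e₀₁₃)) (from-no (e₀₁₃ ⊆? e₀₁₂))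
... | ẽ , EIẽ , ẽ≢e₁ , ẽ≢e₂ , _ with to (EI≐ ẽ) EIẽ
...   | inj₁ ẽ≡e₁ = ẽ≢e₁ ẽ≡e₁
...   | inj₂ ẽ≡e₂ = ẽ≢e₂ ẽ≡e₂

theorem1 :
      ((n : ℕ) (E : Edges n) → IsHypergraph E → IsLinear E → ¬ E ⊤ →
        Σ (Edges n) λ E' → IsHypergraph E' × (EI E' ≐ E))
    × ((n : ℕ) (E E' : Edges n) (e₁ e₂ : Subset n) →
        IsHypergraph E → IsHypergraph E' → E e₁ → E e₂ →
        2 ≤ ∣ e₁ ∩ e₂ ∣ → ¬ (e₁ ⊆ e₂) → ¬ (e₂ ⊆ e₁) →
        (E ≐ EI E') →
        Σ (Subset n) λ ẽ → E ẽ × ẽ ≢ e₁ × ẽ ≢ e₂ × (e₁ ∩ e₂) ⊆ ẽ)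
    × ¬ ((n : ℕ) (E : Edges n) → IsHypergraph E → ¬ E ⊤ →
        Σ (Edges n) λ E' → IsHypergraph E' × (EI E' ≐ E))
theorem1 =
    (λ n E hyp lin ¬E⊤ →
      insertFull E , insertFull-isHypergraph hyp , EI-insertFull hyp lin ¬E⊤)
  , (λ n E E' e₁ e₂ _ _ E₁ E₂ 2≤∣e₁∩e₂∣ e₁⊈e₂ e₂⊈e₁ E≐EI →
      let ẽ , EIẽ , rest = EI-crossing⇒third (to (E≐EI e₁) E₁) (to (E≐EI e₂) E₂)
                                             2≤∣e₁∩e₂∣ e₁⊈e₂ e₂⊈e₁
      in ẽ , from (E≐EI ẽ) EIẽ , rest)
  , (λ realisable →
      let E' , _ , EI≐ = realisable 4 crossingPair crossingPair-isHypergraph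
                                    (λ { (inj₁ ()) ; (inj₂ ()) })
      in crossingPair-not-EI E' EI≐)
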